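{- For every even integer $n>2$ there exists a 3-uniform edge-maximal hypertree $\mathcal{M}=(V,\mathcal{E})$ with $|V|=n$ and $|\mathcal{E}|=\frac{1}{2}\binom{n}{2}-\frac{1}{4}n$.
   Context: A $k$-uniform hypergraph $\mathcal{H}=(V,\mathcal{E})$ consists of a finite vertex set $V$ and a set $\mathcal{E}$ of $k$-element subsets of $V$ (no multiple edges). A $k$-uniform hypergraph is a chain if there is a sequence $v_1,\dots,v_l$ of its vertices in which every vertex appears at least once (possibly more times), $v_1\ne v_l$, and its edge set consists of exactly the $l-k+1$ distinct sets $\{v_i,\dots,v_{i+k-1}\}$, $1\le i\le l-k+1$; it is a semicycle if the same holds with $v_1=v_l$ instead. $\mathcal{H}$ is chain-connected if every pair of distinct vertices is contained in some subhypergraph that is a chain; semicycle-free if no subhypergraph is a semicycle. A hypertree is a chain-connected, semicycle-free $k$-uniform hypergraph. An edge-maximal hypertree is a hypertree $(V,\mathcal{E})$ such that for every $k$-subset $e\subseteq V$ with $e\notin\mathcal{E}$, $(V,\mathcal{E}\cup\{e\})$ is not a hypertree. -}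

module Defs where

open import Data.Nat using (ℕ; suc; _∸_; _≤_; _+_; _*_)
open import Data.Nat.Combinatorics using (_C_)
open import Data.Fin using (Fin)
open import Data.Fin.Subset using (Subset; ⊥; ⁅_⁆; _∪_; ∣_∣)
open import Data.List using (List; []; _∷_; _++_; [_]; map; take; drop; length; upTo; foldr)
import Data.List.Membership.Propositional as LM
open import Data.List.Relation.Unary.All using (All)
open import Data.List.Relation.Unary.Unique.Propositional using (Unique)
open import Data.Product using (Σ; ∃; _×_)
open import Relation.Binary.PropositionalEquality using (_≡_; _≢_)
open import Relation.Nullary using (¬_)

Edges : ℕ → Set
Edges n = List (Subset n)

IsUniformHypergraph : (k n : ℕ) → Edges n → Set
IsUniformHypergraph k n E = Unique E × All (λ e → ∣ e ∣ ≡ k) E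

toSet : {n : ℕ} → List (Fin n) → Subset n
toSet = foldr (λ v s → ⁅ v ⁆ ∪ s) ⊥

-- the l - k + 1 consecutive windows (v_i, ..., v_{i+k-1}), 1 ≤ i ≤ l-k+1
-- (used only when k ≤ l)
windows : {A : Set} → ℕ → List A → List (List A)
windows k xs = map (λ i → take k (drop i xs)) (upTo (suc (length xs ∸ k)))

windowSets : {n : ℕ} → ℕ → List (Fin n) → List (Subset n)
windowSets k vs = map toSet (windows k vs)

-- The sequence vs spans a subhypergraph of E whose edge set consists of
-- exactly the l-k+1 distinct k-sets {v_i,...,v_{i+k-1}} (vertex set = vertices of vs).
WindowsInE : (k n : ℕ) → Edges n → List (Fin n) → Set
WindowsInE k n E vs =
  k ≤ length vs
  × All (λ w → (∣ w ∣ ≡ k) × (w LM.∈ E)) (windowSets k vs)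
  × Unique (windowSets k vs)

IsChainSeq : (k n : ℕ) → Edges n → List (Fin n) → Set
IsChainSeq k n E vs =
  WindowsInE k n E vs
  × Σ (Fin n) (λ a → Σ (List (Fin n)) (λ mid → Σ (Fin n) (λ b →
      (vs ≡ a ∷ (mid ++ [ b ])) × (a ≢ b))))

IsSemicycleSeq : (k n : ℕ) → Edges n → List (Fin n) → Set
IsSemicycleSeq k n E vs =
  WindowsInE k n E vs
  × Σ (Fin n) (λ a → Σ (List (Fin n)) (λ mid →
      vs ≡ a ∷ (mid ++ [ a ])))

ChainConnected : (k n : ℕ) → Edges n → Set
ChainConnected k n E =
  (u v : Fin n) → u ≢ v →
  Σ (List (Fin n)) (λ vs → IsChainSeq k n E vs × (u LM.∈ vs) × (v LM.∈ vs))

SemicycleFree : (k n : ℕ) → Edges n → Set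
SemicycleFree k n E = (vs : List (Fin n)) → ¬ IsSemicycleSeq k n E vs

IsHypertree : (k n : ℕ) → Edges n → Set
IsHypertree k n E = IsUniformHypergraph k n E × ChainConnected k n E × SemicycleFree k n E

IsEdgeMaximalHypertree : (k n : ℕ) → Edges n → Set
IsEdgeMaximalHypertree k n E =
  IsHypertree k n E
  × ((e : Subset n) → ∣ e ∣ ≡ k → ¬ (e LM.∈ E) → ¬ IsHypertree k n (e ∷ E))

module Submission where

open import Defs
open import Data.Nat using (ℕ; _<_; _+_; _*_)
open import Data.Nat.Combinatorics using (_C_)
open import Data.List using (length)
open import Data.Product using (Σ; _×_)
open import Relation.Binary.PropositionalEquality using (_≡_)

open import Data.Nat as ℕ using (zero; suc; _≤_; z≤n; s≤s; ⌊_/2⌋; ⌈_/2⌉)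
import Data.Nat.Properties as ℕ
open import Data.Nat.Combinatorics using (nC1≡n; nCk+nC[k+1]≡[n+1]C[k+1])
open import Data.Nat.Tactic.RingSolver using (solve-∀)
open import Data.Fin as Fin using (Fin; toℕ; fromℕ<)
open import Data.Fin.Properties using (toℕ-injective; toℕ-fromℕ<; toℕ<n)
open import Data.Fin.Subset using (Subset; ⁅_⁆; _∪_; ∣_∣; inside; outside)
  renaming (_∈_ to _∈ₛ_; _∉_ to _∉ₛ_)
open import Data.Fin.Subset.Properties
  using (x∈p∪q⁻; x∈p∪q⁺; x∈⁅x⁆; x∈⁅y⁆⇒x≡y; ∉⊥; ⊆-antisym; ∪-identityˡ; ∣⊥∣≡0; _∈?_)
open import Data.Vec.Base using ([]; _∷_; here; there; tabulate)
open import Data.Vec.Properties using (lookup∘tabulate; lookup⇒[]=; []=⇒lookup)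
open import Data.List using (List; []; _∷_; map; _++_; [_]; upTo)
open import Data.List.Properties
  using (length-map; length-++; length-upTo; ∷-injectiveˡ; ∷-injectiveʳ; ∷ʳ-injective)
open import Data.List.Membership.Propositional using (_∈_; _∉_)
open import Data.List.Membership.Propositional.Properties
  using (∈-map⁺; ∈-map⁻; ∈-++⁺ˡ; ∈-++⁺ʳ; ∈-++⁻; ∈-upTo⁺; ∈-upTo⁻)
open import Data.List.Relation.Unary.Any using (here; there)
import Data.List.Relation.Unary.All as All
import Data.List.Relation.Unary.All.Properties as All
open import Data.List.Relation.Unary.AllPairs using (AllPairs; []; _∷_)
import Data.List.Relation.Unary.AllPairs as AllPairs
import Data.List.Relation.Unary.AllPairs.Properties as AllPairs
open import Data.List.Relation.Unary.Unique.Propositional using (Unique)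
import Data.List.Relation.Unary.Unique.Propositional.Properties as Unique
open import Data.Sum as Sum using (_⊎_; inj₁; inj₂; [_,_]′)
open import Data.Product as Product using (_,_; proj₁; proj₂; uncurry)
open import Data.Empty using (⊥-elim)
open import Function using (_∘_)
open import Relation.Nullary using (¬_; yes; no; does; contradiction)
open import Relation.Nullary.Decidable using (_⊎-dec_; dec-true)
open import Relation.Unary using (Decidable)
open import Relation.Binary.PropositionalEquality
  using (refl; sym; trans; cong; cong₂; subst; subst₂; _≢_; module ≡-Reasoning)

-- Split the vertex set {0, …, 2m-1} into m levels, level i = {2i, 2i+1},
-- and let M consist of the 3-sets {2i, 2i+1, j} with j on a level above i.  With j fixed there
-- are ⌊ j /2⌋ choices of i, so |M| = Σ_{j<2m} ⌊ j /2⌋ = m(m-1) = ½·C(2m,2) - ½·m.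
--
-- * Chain-connected: any two vertices are joined by at most two windows through level 0.
-- * Semicycle-free: two distinct consecutive windows x y z, y z w of M always share a level pair
--   {y, z}; so three consecutive windows would put three distinct vertices on one level.  The
--   shorter closed sequences fail because of distinctness of their vertices or windows.
-- * Edge-maximal: write a new 3-set as x < y < z.  If x and y share a level it already is an
--   edge; otherwise x lies strictly below y and z, and with x′ the partner of x the sequence
--   y z x x′ y is a semicycle whose other windows {x, x′, z}, {x, x′, y} are edges.

private variable
  n : ℕ
  x a b c : Fin n

∈-toSet⁺ : {vs : List (Fin n)} → x ∈ vs → x ∈ₛ toSet vs
∈-toSet⁺ {vs = v ∷ vs} (here refl) = x∈p∪q⁺ (inj₁ (x∈⁅x⁆ v))
∈-toSet⁺ {vs = v ∷ vs} (there x∈vs) = x∈p∪q⁺ (inj₂ (∈-toSet⁺ x∈vs))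

∈-toSet⁻ : (vs : List (Fin n)) → x ∈ₛ toSet vs → x ∈ vs
∈-toSet⁻ [] x∈⊥ = ⊥-elim (∉⊥ x∈⊥)
∈-toSet⁻ (v ∷ vs) x∈ with x∈p∪q⁻ ⁅ v ⁆ (toSet vs) x∈
... | inj₁ x∈v = here (x∈⁅y⁆⇒x≡y v x∈v)
... | inj₂ x∈vs = there (∈-toSet⁻ vs x∈vs)

toSet-cong : {vs ws : List (Fin n)} →
  (∀ {x} → x ∈ vs → x ∈ ws) → (∀ {x} → x ∈ ws → x ∈ vs) → toSet vs ≡ toSet ws
toSet-cong {vs = vs} {ws} vs⊆ws ws⊆vs =
  ⊆-antisym (∈-toSet⁺ ∘ vs⊆ws ∘ ∈-toSet⁻ vs) (∈-toSet⁺ ∘ ws⊆vs ∘ ∈-toSet⁻ ws)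

⟪_,_,_⟫ : Fin n → Fin n → Fin n → Subset n
⟪ a , b , c ⟫ = toSet (a ∷ b ∷ c ∷ [])

rotate : ⟪ a , b , c ⟫ ≡ ⟪ b , c , a ⟫
rotate = toSet-cong forward backward
  where
  forward : x ∈ a ∷ b ∷ c ∷ [] → x ∈ b ∷ c ∷ a ∷ []
  forward (here refl) = there (there (here refl))
  forward (there (here refl)) = here refl
  forward (there (there (here refl))) = there (here refl)
  backward : x ∈ b ∷ c ∷ a ∷ [] → x ∈ a ∷ b ∷ c ∷ []
  backward (here refl) = there (here refl)
  backward (there (here refl)) = there (there (here refl))
  backward (there (there (here refl))) = here refl

select : {P : Fin n → Set} → Decidable P → Subset n
select P? = tabulate (λ x → does (P? x))

module _ {P : Fin n → Set} (P? : Decidable P) where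

  ∈-select⁺ : P x → x ∈ₛ select P?
  ∈-select⁺ {x} px = lookup⇒[]= x _ (trans (lookup∘tabulate _ x) (dec-true (P? x) px))

  ∈-select⁻ : x ∈ₛ select P? → P x
  ∈-select⁻ {x} x∈ with P? x | trans (sym (lookup∘tabulate (λ y → does (P? y)) x)) ([]=⇒lookup x∈)
  ... | yes px | _ = px
  ... | no _ | ()

∣⁅x⁆∪p∣≡1+∣p∣ : ∀ (x : Fin n) p → x ∉ₛ p → ∣ ⁅ x ⁆ ∪ p ∣ ≡ suc ∣ p ∣
∣⁅x⁆∪p∣≡1+∣p∣ Fin.zero (inside ∷ p) x∉p = ⊥-elim (x∉p here)
∣⁅x⁆∪p∣≡1+∣p∣ Fin.zero (outside ∷ p) x∉p = cong (suc ∘ ∣_∣) (∪-identityˡ p)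
∣⁅x⁆∪p∣≡1+∣p∣ (Fin.suc x) (inside ∷ p) x∉p = cong suc (∣⁅x⁆∪p∣≡1+∣p∣ x p (x∉p ∘ there))
∣⁅x⁆∪p∣≡1+∣p∣ (Fin.suc x) (outside ∷ p) x∉p = ∣⁅x⁆∪p∣≡1+∣p∣ x p (x∉p ∘ there)

∣⁅x⁆∪p∣≡∣p∣ : ∀ (x : Fin n) p → x ∈ₛ p → ∣ ⁅ x ⁆ ∪ p ∣ ≡ ∣ p ∣
∣⁅x⁆∪p∣≡∣p∣ Fin.zero (inside ∷ p) _ = cong (suc ∘ ∣_∣) (∪-identityˡ p)
∣⁅x⁆∪p∣≡∣p∣ (Fin.suc x) (inside ∷ p) (there x∈p) = cong suc (∣⁅x⁆∪p∣≡∣p∣ x p x∈p)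
∣⁅x⁆∪p∣≡∣p∣ (Fin.suc x) (outside ∷ p) (there x∈p) = ∣⁅x⁆∪p∣≡∣p∣ x p x∈p

∣toSet∣≤length : (vs : List (Fin n)) → ∣ toSet vs ∣ ≤ length vs
∣toSet∣≤length {n = n} [] = ℕ.≤-reflexive (∣⊥∣≡0 n)
∣toSet∣≤length (v ∷ vs) with v ∈? toSet vs
... | yes v∈ = ℕ.≤-trans (ℕ.≤-reflexive (∣⁅x⁆∪p∣≡∣p∣ v (toSet vs) v∈)) (ℕ.m≤n⇒m≤1+n (∣toSet∣≤length vs))
... | no v∉ = ℕ.≤-trans (ℕ.≤-reflexive (∣⁅x⁆∪p∣≡1+∣p∣ v (toSet vs) v∉)) (s≤s (∣toSet∣≤length vs))

unique⇒∣toSet∣≡length : {vs : List (Fin n)} → Unique vs → ∣ toSet vs ∣ ≡ length vs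
unique⇒∣toSet∣≡length {n = n} [] = ∣⊥∣≡0 n
unique⇒∣toSet∣≡length {vs = v ∷ vs} (v≢vs ∷ vs!) =
  trans (∣⁅x⁆∪p∣≡1+∣p∣ v (toSet vs) v∉vs) (cong suc (unique⇒∣toSet∣≡length vs!))
  where
  v∉vs : v ∉ₛ toSet vs
  v∉vs v∈ = All.lookup v≢vs (∈-toSet⁻ vs v∈) refl

∣toSet∣≡length⇒unique : (vs : List (Fin n)) → ∣ toSet vs ∣ ≡ length vs → Unique vs
∣toSet∣≡length⇒unique [] _ = []
∣toSet∣≡length⇒unique (v ∷ vs) eq with v ∈? toSet vs
... | yes v∈ = ⊥-elim (ℕ.<-irrefl refl (ℕ.≤-trans too-many (∣toSet∣≤length vs)))
  where
  too-many : suc (length vs) ≤ ∣ toSet vs ∣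
  too-many = ℕ.≤-reflexive (trans (sym eq) (∣⁅x⁆∪p∣≡∣p∣ v (toSet vs) v∈))
... | no v∉ = All.tabulate (λ w∈vs v≡w → v∉ (∈-toSet⁺ (subst (_∈ vs) (sym v≡w) w∈vs)))
            ∷ ∣toSet∣≡length⇒unique vs (ℕ.suc-injective (trans (sym (∣⁅x⁆∪p∣≡1+∣p∣ v (toSet vs) v∉)) eq))

distinct⇒∣⟪⟫∣≡3 : a ≢ b → a ≢ c → b ≢ c → ∣ ⟪ a , b , c ⟫ ∣ ≡ 3
distinct⇒∣⟪⟫∣≡3 a≢b a≢c b≢c =
  unique⇒∣toSet∣≡length ((a≢b All.∷ a≢c All.∷ All.[]) ∷ (b≢c All.∷ All.[]) ∷ All.[] ∷ [])

∣⟪⟫∣≡3⇒distinct : ∣ ⟪ a , b , c ⟫ ∣ ≡ 3 → a ≢ b × a ≢ c × b ≢ c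
∣⟪⟫∣≡3⇒distinct {a = a} {b} {c} card with ∣toSet∣≡length⇒unique (a ∷ b ∷ c ∷ []) card
... | (a≢b All.∷ a≢c All.∷ All.[]) ∷ (b≢c All.∷ All.[]) ∷ _ = a≢b , a≢c , b≢c

elements : Subset n → List (Fin n)
elements [] = []
elements (inside ∷ p) = Fin.zero ∷ map Fin.suc (elements p)
elements (outside ∷ p) = map Fin.suc (elements p)

∈-elements⁺ : (p : Subset n) → x ∈ₛ p → x ∈ elements p
∈-elements⁺ (inside ∷ p) here = here refl
∈-elements⁺ (inside ∷ p) (there x∈p) = there (∈-map⁺ Fin.suc (∈-elements⁺ p x∈p))
∈-elements⁺ (outside ∷ p) (there x∈p) = ∈-map⁺ Fin.suc (∈-elements⁺ p x∈p)

∈-elements⁻ : (p : Subset n) → x ∈ elements p → x ∈ₛ p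
∈-elements⁻ (inside ∷ p) (here refl) = here
∈-elements⁻ (inside ∷ p) (there x∈) with ∈-map⁻ Fin.suc x∈
... | y , y∈ , refl = there (∈-elements⁻ p y∈)
∈-elements⁻ (outside ∷ p) x∈ with ∈-map⁻ Fin.suc x∈
... | y , y∈ , refl = there (∈-elements⁻ p y∈)

toSet-elements : (p : Subset n) → toSet (elements p) ≡ p
toSet-elements p = ⊆-antisym (∈-elements⁻ p ∘ ∈-toSet⁻ (elements p)) (∈-toSet⁺ ∘ ∈-elements⁺ p)

length-elements : (p : Subset n) → length (elements p) ≡ ∣ p ∣
length-elements [] = refl
length-elements (inside ∷ p) = cong suc (trans (length-map Fin.suc (elements p)) (length-elements p))
length-elements (outside ∷ p) = trans (length-map Fin.suc (elements p)) (length-elements p)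

elements-increasing : (p : Subset n) → AllPairs Fin._<_ (elements p)
elements-increasing [] = []
elements-increasing (inside ∷ p) =
  All.map⁺ (All.universal (λ _ → s≤s z≤n) _) ∷ AllPairs.map⁺ (AllPairs.map s≤s (elements-increasing p))
elements-increasing (outside ∷ p) = AllPairs.map⁺ (AllPairs.map s≤s (elements-increasing p))

3-set-increasing : (p : Subset n) → ∣ p ∣ ≡ 3 →
  Σ (Fin n) λ x → Σ (Fin n) λ y → Σ (Fin n) λ z → x Fin.< y × y Fin.< z × p ≡ ⟪ x , y , z ⟫
3-set-increasing p card with elements p | toSet-elements p | length-elements p | elements-increasing p
... | x ∷ y ∷ z ∷ [] | p≡ | _ | (x<y All.∷ _) ∷ (y<z All.∷ _) ∷ _ = x , y , z , x<y , y<z , sym p≡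
... | [] | _ | len | _ = contradiction (trans len card) λ ()
... | _ ∷ [] | _ | len | _ = contradiction (trans len card) λ ()
... | _ ∷ _ ∷ [] | _ | len | _ = contradiction (trans len card) λ ()
... | _ ∷ _ ∷ _ ∷ _ ∷ _ | _ | len | _ = contradiction (trans len card) λ ()

two-values : {A : Set} {u v x y z : A} → x ≡ u ⊎ x ≡ v → y ≡ u ⊎ y ≡ v → z ≡ u ⊎ z ≡ v →
  x ≢ y → z ≡ x ⊎ z ≡ y
two-values (inj₁ refl) (inj₁ refl) _ x≢y = contradiction refl x≢y
two-values (inj₂ refl) (inj₂ refl) _ x≢y = contradiction refl x≢y
two-values (inj₁ refl) (inj₂ refl) (inj₁ refl) _ = inj₁ refl
two-values (inj₁ refl) (inj₂ refl) (inj₂ refl) _ = inj₂ refl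
two-values (inj₂ refl) (inj₁ refl) (inj₁ refl) _ = inj₂ refl
two-values (inj₂ refl) (inj₁ refl) (inj₂ refl) _ = inj₁ refl

closed-ends : {A : Set} (xs : List A) {x y a : A} (mid : List A) →
  x ∷ (xs ++ [ y ]) ≡ a ∷ (mid ++ [ a ]) → x ≡ y
closed-ends xs mid closed =
  trans (∷-injectiveˡ closed) (sym (proj₂ (∷ʳ-injective xs mid (∷-injectiveʳ closed))))

map-unique : {A B : Set} {P : A → Set} (f : A → B) → (∀ {x y} → P x → f x ≡ f y → x ≡ y) →
  {xs : List A} → All.All P xs → Unique xs → Unique (map f xs)
map-unique f inj All.[] [] = []
map-unique f inj (px All.∷ pxs) (x≢xs ∷ xs!) =
  All.map⁺ (All.map (λ x≢y fx≡fy → x≢y (inj px fx≡fy)) x≢xs) ∷ map-unique f inj pxs xs!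

⌊t/2⌋-cases : ∀ t → t ≡ ⌊ t /2⌋ + ⌊ t /2⌋ ⊎ t ≡ suc (⌊ t /2⌋ + ⌊ t /2⌋)
⌊t/2⌋-cases zero = inj₁ refl
⌊t/2⌋-cases (suc zero) = inj₂ refl
⌊t/2⌋-cases (suc (suc t)) with ⌊t/2⌋-cases t
... | inj₁ e = inj₁ (cong suc (trans (cong suc e) (sym (ℕ.+-suc ⌊ t /2⌋ ⌊ t /2⌋))))
... | inj₂ e = inj₂ (cong (suc ∘ suc) (trans e (sym (ℕ.+-suc ⌊ t /2⌋ ⌊ t /2⌋))))

⌊2h/2⌋≡h : ∀ h → ⌊ h + h /2⌋ ≡ h
⌊2h/2⌋≡h h = sym (ℕ.n≡⌊n+n/2⌋ h)

⌊2h+1/2⌋≡h : ∀ h → ⌊ suc (h + h) /2⌋ ≡ h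
⌊2h+1/2⌋≡h h = sym (ℕ.n≡⌈n+n/2⌉ h)

2*m≡m+m : ∀ m → 2 * m ≡ m + m
2*m≡m+m m = cong (m +_) (ℕ.+-identityʳ m)

⌊t/2⌋<m : ∀ {t m} → t < 2 * m → ⌊ t /2⌋ < m
⌊t/2⌋<m {t} {m} t<2m = ℕ.≰⇒> λ m≤h → ℕ.<⇒≱ t<2m (ℕ.≤-trans (2m≤2h m≤h) 2h≤t)
  where
  2m≤2h : m ≤ ⌊ t /2⌋ → 2 * m ≤ ⌊ t /2⌋ + ⌊ t /2⌋
  2m≤2h m≤h = subst (_≤ ⌊ t /2⌋ + ⌊ t /2⌋) (sym (2*m≡m+m m)) (ℕ.+-mono-≤ m≤h m≤h)
  2h≤t : ⌊ t /2⌋ + ⌊ t /2⌋ ≤ t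
  2h≤t with ⌊t/2⌋-cases t
  ... | inj₁ e = ℕ.≤-reflexive (sym e)
  ... | inj₂ e = ℕ.≤-trans (ℕ.n≤1+n _) (ℕ.≤-reflexive (sym e))

2h+1<2m : ∀ {h m} → h < m → suc (h + h) < 2 * m
2h+1<2m {h} {m} h<m = subst₂ _≤_ (cong suc (ℕ.+-suc h h)) (sym (2*m≡m+m m)) (ℕ.+-mono-≤ h<m h<m)

level : Fin n → ℕ
level x = ⌊ toℕ x /2⌋

level-mono : x Fin.< a → level x ≤ level a
level-mono x<a = ℕ.⌊n/2⌋-mono (ℕ.<⇒≤ x<a)

level-at-most-two : level a ≡ level b → a ≢ b → level c ≡ level a → c ≡ a ⊎ c ≡ b
level-at-most-two {a = a} {b} {c} a~b a≢b c~a =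
  Sum.map toℕ-injective toℕ-injective
    (two-values (number a refl) (number b (sym a~b)) (number c c~a) (a≢b ∘ toℕ-injective))
  where
  number : (x : Fin _) → level x ≡ level a → toℕ x ≡ level a + level a ⊎ toℕ x ≡ suc (level a + level a)
  number x x~a = subst (λ h → toℕ x ≡ h + h ⊎ toℕ x ≡ suc (h + h)) x~a (⌊t/2⌋-cases (toℕ x))

Admissible : ℕ → ℕ × ℕ → Set
Admissible n (i , j) = i < ⌊ j /2⌋ × j < n

apexPairs : ℕ → List (ℕ × ℕ)
apexPairs zero = []
apexPairs (suc j) = map (_, j) (upTo ⌊ j /2⌋) ++ apexPairs j

∈-apexPairs⁺ : ∀ {n ij} → Admissible n ij → ij ∈ apexPairs n
∈-apexPairs⁺ {suc n} {i , j} (i<j , j<1+n) with ℕ.m≤n⇒m<n∨m≡n (ℕ.s≤s⁻¹ j<1+n)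
... | inj₁ j<n = ∈-++⁺ʳ _ (∈-apexPairs⁺ (i<j , j<n))
... | inj₂ refl = ∈-++⁺ˡ (∈-map⁺ (_, j) (∈-upTo⁺ i<j))

∈-apexPairs⁻ : ∀ {n ij} → ij ∈ apexPairs n → Admissible n ij
∈-apexPairs⁻ {suc n} ij∈ with ∈-++⁻ (map (_, n) (upTo ⌊ n /2⌋)) ij∈
... | inj₂ ij∈′ = Product.map₂ ℕ.m<n⇒m<1+n (∈-apexPairs⁻ ij∈′)
... | inj₁ ij∈′ with ∈-map⁻ (_, n) ij∈′
...   | i , i∈ , refl = ∈-upTo⁻ i∈ , ℕ.n<1+n n

apexPairs-unique : ∀ n → Unique (apexPairs n)
apexPairs-unique zero = []
apexPairs-unique (suc n) =
  Unique.++⁺ (Unique.map⁺ (cong proj₁) (Unique.upTo⁺ ⌊ n /2⌋)) (apexPairs-unique n) disjoint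
  where
  disjoint : ∀ {ij} → ¬ (ij ∈ map (_, n) (upTo ⌊ n /2⌋) × ij ∈ apexPairs n)
  disjoint (ij∈ , ij∈′) with ∈-map⁻ (_, n) ij∈
  ... | _ , _ , refl = ℕ.<-irrefl refl (proj₂ (∈-apexPairs⁻ ij∈′))

-- Two steps up add ⌈ n /2⌉ + ⌊ n /2⌋ = n admissible pairs.
length-apexPairs : ∀ n → length (apexPairs (suc (suc n))) ≡ n + length (apexPairs n)
length-apexPairs n = begin
  length (apexPairs (suc (suc n)))
    ≡⟨ length-++ (map (_, suc n) (upTo ⌊ suc n /2⌋)) ⟩
  length (map (_, suc n) (upTo ⌊ suc n /2⌋)) + length (apexPairs (suc n))
    ≡⟨ cong₂ _+_ (length-column (suc n)) (length-++ (map (_, n) (upTo ⌊ n /2⌋))) ⟩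
  ⌈ n /2⌉ + (length (map (_, n) (upTo ⌊ n /2⌋)) + length (apexPairs n))
    ≡⟨ cong (λ k → ⌈ n /2⌉ + (k + length (apexPairs n))) (length-column n) ⟩
  ⌈ n /2⌉ + (⌊ n /2⌋ + length (apexPairs n))
    ≡⟨ sym (ℕ.+-assoc ⌈ n /2⌉ ⌊ n /2⌋ _) ⟩
  ⌈ n /2⌉ + ⌊ n /2⌋ + length (apexPairs n)
    ≡⟨ cong (_+ length (apexPairs n)) (trans (ℕ.+-comm ⌈ n /2⌉ ⌊ n /2⌋) (ℕ.⌊n/2⌋+⌈n/2⌉≡n n)) ⟩
  n + length (apexPairs n) ∎
  where
  open ≡-Reasoning
  length-column : ∀ j → length (map (_, j) (upTo ⌊ j /2⌋)) ≡ ⌊ j /2⌋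
  length-column j = trans (length-map (_, j) (upTo ⌊ j /2⌋)) (length-upTo ⌊ j /2⌋)

-- Pascal's rule twice: C(n+2, 2) = (n+1) + n + C(n, 2).
C2-step : ∀ n → suc (suc n) C 2 ≡ suc n + (n + n C 2)
C2-step n = begin
  suc (suc n) C 2            ≡⟨ sym (nCk+nC[k+1]≡[n+1]C[k+1] (suc n) 1) ⟩
  suc n C 1 + suc n C 2      ≡⟨ cong₂ _+_ (nC1≡n (suc n)) (sym (nCk+nC[k+1]≡[n+1]C[k+1] n 1)) ⟩
  suc n + (n C 1 + n C 2)    ≡⟨ cong (λ k → suc n + (k + n C 2)) (nC1≡n n) ⟩
  suc n + (n + n C 2)        ∎
  where open ≡-Reasoning

-- There are m(m-1) admissible pairs below 2m, i.e. 4·|pairs| + 2m = 2·C(2m, 2).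
count-apexPairs : ∀ m → 4 * length (apexPairs (2 * m)) + 2 * m ≡ 2 * ((2 * m) C 2)
count-apexPairs zero = refl
count-apexPairs (suc m) =
  subst (λ n → 4 * length (apexPairs n) + n ≡ 2 * (n C 2)) (sym (ℕ.*-suc 2 m))
    (step (2 * m) (count-apexPairs m))
  where
  open ≡-Reasoning
  regroup : ∀ n l → 4 * (n + l) + (2 + n) ≡ (4 * n + 2) + (4 * l + n)
  regroup = solve-∀
  collect : ∀ n c → (4 * n + 2) + 2 * c ≡ 2 * (suc n + (n + c))
  collect = solve-∀
  step : ∀ n → 4 * length (apexPairs n) + n ≡ 2 * (n C 2) →
         4 * length (apexPairs (2 + n)) + (2 + n) ≡ 2 * ((2 + n) C 2)
  step n ih = begin
    4 * length (apexPairs (2 + n)) + (2 + n)      ≡⟨ cong (λ l → 4 * l + (2 + n)) (length-apexPairs n) ⟩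
    4 * (n + length (apexPairs n)) + (2 + n)      ≡⟨ regroup n (length (apexPairs n)) ⟩
    (4 * n + 2) + (4 * length (apexPairs n) + n)  ≡⟨ cong ((4 * n + 2) +_) ih ⟩
    (4 * n + 2) + 2 * (n C 2)                     ≡⟨ collect n (n C 2) ⟩
    2 * (suc n + (n + n C 2))                     ≡⟨ cong (2 *_) (sym (C2-step n)) ⟩
    2 * ((2 + n) C 2)                             ∎

module Construction (m : ℕ) where

  N : ℕ
  N = 2 * m

  level<m : (x : Fin N) → level x < m
  level<m x = ⌊t/2⌋<m (toℕ<n x)

  level-pair : ∀ {i} → i < m → Σ (Fin N) λ a → Σ (Fin N) λ b → a ≢ b × level a ≡ i × level b ≡ i
  level-pair {i} i<m = fromℕ< 2i<N , fromℕ< 2i+1<N , distinct ,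
      trans (cong ⌊_/2⌋ (toℕ-fromℕ< 2i<N)) (⌊2h/2⌋≡h i) ,
      trans (cong ⌊_/2⌋ (toℕ-fromℕ< 2i+1<N)) (⌊2h+1/2⌋≡h i)
    where
    2i+1<N : suc (i + i) < N
    2i+1<N = 2h+1<2m i<m
    2i<N : i + i < N
    2i<N = ℕ.<-trans (ℕ.n<1+n (i + i)) 2i+1<N
    distinct : fromℕ< 2i<N ≢ fromℕ< 2i+1<N
    distinct eq = ℕ.1+n≢n (sym (trans (sym (toℕ-fromℕ< 2i<N)) (trans (cong toℕ eq) (toℕ-fromℕ< 2i+1<N))))

  partner : (x : Fin N) → Σ (Fin N) λ y → x ≢ y × level y ≡ level x
  partner x with level-pair (level<m x)
  ... | a , b , a≢b , a~ , b~ with level-at-most-two (trans a~ (sym b~)) a≢b (sym a~)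
  ...   | inj₁ refl = b , a≢b , b~
  ...   | inj₂ refl = a , (λ b≡a → a≢b (sym b≡a)) , a~

  OnEdge : ℕ → ℕ → Fin N → Set
  OnEdge i j x = level x ≡ i ⊎ toℕ x ≡ j

  onEdge? : ∀ i j → Decidable (OnEdge i j)
  onEdge? i j x = (level x ℕ.≟ i) ⊎-dec (toℕ x ℕ.≟ j)

  edge : ℕ → ℕ → Subset N
  edge i j = select (onEdge? i j)

  ∈-edge⁻ : ∀ {x i j} → x ∈ₛ edge i j → OnEdge i j x
  ∈-edge⁻ {i = i} {j} = ∈-select⁻ (onEdge? i j)

  ∈-edge⁺ : ∀ {x i j} → OnEdge i j x → x ∈ₛ edge i j
  ∈-edge⁺ {i = i} {j} = ∈-select⁺ (onEdge? i j)

  on : ∀ {i j x} (vs : List (Fin N)) → toSet vs ≡ edge i j → x ∈ vs → OnEdge i j x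
  on _ vs≡ x∈ = ∈-edge⁻ (subst (_ ∈ₛ_) vs≡ (∈-toSet⁺ x∈))

  apex-above : ∀ {i j} {x : Fin N} → Admissible N (i , j) → toℕ x ≡ j → i < level x
  apex-above (i<j , _) refl = i<j

  M : Edges N
  M = map (uncurry edge) (apexPairs N)

  triple≡edge : {a b c : Fin N} → a ≢ b → level a ≡ level b → ⟪ a , b , c ⟫ ≡ edge (level a) (toℕ c)
  triple≡edge {a} {b} {c} a≢b a~b =
    ⊆-antisym (∈-edge⁺ ∘ on-edge ∘ ∈-toSet⁻ (a ∷ b ∷ c ∷ [])) (∈-toSet⁺ ∘ in-triple ∘ ∈-edge⁻)
    where
    on-edge : ∀ {x} → x ∈ a ∷ b ∷ c ∷ [] → OnEdge (level a) (toℕ c) x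
    on-edge (here refl) = inj₁ refl
    on-edge (there (here refl)) = inj₁ (sym a~b)
    on-edge (there (there (here refl))) = inj₂ refl
    in-triple : ∀ {x} → OnEdge (level a) (toℕ c) x → x ∈ a ∷ b ∷ c ∷ []
    in-triple (inj₂ x≡c) = there (there (here (toℕ-injective x≡c)))
    in-triple (inj₁ x~a) with level-at-most-two a~b a≢b x~a
    ... | inj₁ x≡a = here x≡a
    ... | inj₂ x≡b = there (here x≡b)

  triple∈M : {a b c : Fin N} → a ≢ b → level a ≡ level b → level a < level c → ⟪ a , b , c ⟫ ∈ M
  triple∈M {c = c} a≢b a~b a<c =
    subst (_∈ M) (sym (triple≡edge a≢b a~b)) (∈-map⁺ (uncurry edge) (∈-apexPairs⁺ (a<c , toℕ<n c)))

  M-elim : ∀ {w} → w ∈ M → Σ (ℕ × ℕ) λ ij → Admissible N ij × w ≡ uncurry edge ij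
  M-elim w∈M with ∈-map⁻ (uncurry edge) w∈M
  ... | ij , ij∈ , refl = ij , ∈-apexPairs⁻ ij∈ , refl

  record Span (i j : ℕ) : Set where
    field
      x₁ x₂ apex : Fin N
      x₁≢x₂ : x₁ ≢ x₂
      level-x₁ : level x₁ ≡ i
      level-x₂ : level x₂ ≡ i
      apex-is-j : toℕ apex ≡ j

    edge≡ : edge i j ≡ ⟪ x₁ , x₂ , apex ⟫
    edge≡ = sym (subst₂ (λ l t → ⟪ x₁ , x₂ , apex ⟫ ≡ edge l t) level-x₁ apex-is-j
                 (triple≡edge x₁≢x₂ (trans level-x₁ (sym level-x₂))))

  span : ∀ {i j} → Admissible N (i , j) → Span i j
  span (i<j , j<N) with level-pair (ℕ.<-trans i<j (⌊t/2⌋<m j<N))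
  ... | a , b , a≢b , level-a , level-b = record
    { x₁ = a ; x₂ = b ; apex = fromℕ< j<N ; x₁≢x₂ = a≢b ; level-x₁ = level-a ; level-x₂ = level-b
    ; apex-is-j = toℕ-fromℕ< j<N }

  edge-card : ∀ {i j} → Admissible N (i , j) → ∣ edge i j ∣ ≡ 3
  edge-card {i} adm =
    trans (cong ∣_∣ edge≡) (distinct⇒∣⟪⟫∣≡3 x₁≢x₂ (below-apex level-x₁) (below-apex level-x₂))
    where
    open Span (span adm)
    below-apex : ∀ {x} → level x ≡ i → x ≢ apex
    below-apex x-on-i refl = ℕ.<-irrefl (sym x-on-i) (apex-above adm apex-is-j)

  -- An edge determines its admissible pair: its apex is the one vertex off its base level.
  edge-injective : ∀ {i j i′ j′} → Admissible N (i , j) → edge i j ≡ edge i′ j′ → (i , j) ≡ (i′ , j′)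
  edge-injective {i} {j} {i′} {j′} adm eq = cong₂ _,_ i≡i′ j≡j′
    where
    open Span (span adm)
    on′ : ∀ {x} → x ∈ x₁ ∷ x₂ ∷ apex ∷ [] → OnEdge i′ j′ x
    on′ = on (x₁ ∷ x₂ ∷ apex ∷ []) (trans (sym edge≡) eq)
    i≡i′ : i ≡ i′
    i≡i′ with on′ (here refl) | on′ (there (here refl))
    ... | inj₁ x₁-on-i′ | _ = trans (sym level-x₁) x₁-on-i′
    ... | inj₂ _ | inj₁ x₂-on-i′ = trans (sym level-x₂) x₂-on-i′
    ... | inj₂ x₁-is-j′ | inj₂ x₂-is-j′ = contradiction (toℕ-injective (trans x₁-is-j′ (sym x₂-is-j′))) x₁≢x₂
    j≡j′ : j ≡ j′
    j≡j′ with on′ (there (there (here refl)))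
    ... | inj₁ apex-on-i′ = contradiction (trans apex-on-i′ (sym i≡i′)) (ℕ.>⇒≢ (apex-above adm apex-is-j))
    ... | inj₂ apex-is-j′ = trans (sym apex-is-j) apex-is-j′

  -- M is a 3-uniform hypergraph: admissible pairs are listed once and give distinct 3-sets.
  M-uniform : IsUniformHypergraph 3 N M
  M-uniform = map-unique (uncurry edge) edge-injective admissible (apexPairs-unique N)
            , All.map⁺ (All.map edge-card admissible)
    where
    admissible : All.All (Admissible N) (apexPairs N)
    admissible = All.tabulate ∈-apexPairs⁻

  M-card : ∀ {w} → w ∈ M → ∣ w ∣ ≡ 3
  M-card = All.lookup (proj₂ M-uniform)

  base-and-apex : ∀ {i j} {y z : Fin N} → level y ≢ level z → OnEdge i j y → OnEdge i j z →
    (level y ≡ i × toℕ z ≡ j) ⊎ (toℕ y ≡ j × level z ≡ i)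
  base-and-apex y≁z (inj₁ y-on-i) (inj₁ z-on-i) = contradiction (trans y-on-i (sym z-on-i)) y≁z
  base-and-apex y≁z (inj₂ y-is-j) (inj₂ z-is-j) =
    contradiction (cong level (toℕ-injective (trans y-is-j (sym z-is-j)))) y≁z
  base-and-apex y≁z (inj₁ y-on-i) (inj₂ z-is-j) = inj₁ (y-on-i , z-is-j)
  base-and-apex y≁z (inj₂ y-is-j) (inj₁ z-on-i) = inj₂ (y-is-j , z-on-i)

  -- Two distinct admissible edges share two vertices only if these form a level pair: with the
  -- same roles in both edges the edges would coincide, with swapped roles each vertex would lie
  -- above the other.
  shared-pair : ∀ {i j i′ j′} {y z : Fin N} → Admissible N (i , j) → Admissible N (i′ , j′) →
    (i , j) ≢ (i′ , j′) → OnEdge i j y → OnEdge i j z → OnEdge i′ j′ y → OnEdge i′ j′ z → level y ≡ level z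
  shared-pair {y = y} {z} adm adm′ ij≢ y-on z-on y-on′ z-on′ with level y ℕ.≟ level z
  ... | yes y~z = y~z
  ... | no y≁z with base-and-apex y≁z y-on z-on | base-and-apex y≁z y-on′ z-on′
  ... | inj₁ (y-on-i , z-is-j) | inj₁ (y-on-i′ , z-is-j′) =
        contradiction (cong₂ _,_ (trans (sym y-on-i) y-on-i′) (trans (sym z-is-j) z-is-j′)) ij≢
  ... | inj₂ (y-is-j , z-on-i) | inj₂ (y-is-j′ , z-on-i′) =
        contradiction (cong₂ _,_ (trans (sym z-on-i) z-on-i′) (trans (sym y-is-j) y-is-j′)) ij≢
  ... | inj₁ (y-on-i , z-is-j) | inj₂ (y-is-j′ , z-on-i′) =
        ⊥-elim (ℕ.<-asym (subst (_< level z) (sym y-on-i) (apex-above adm z-is-j))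
                         (subst (_< level y) (sym z-on-i′) (apex-above adm′ y-is-j′)))
  ... | inj₂ (y-is-j , z-on-i) | inj₁ (y-on-i′ , z-is-j′) =
        ⊥-elim (ℕ.<-asym (subst (_< level z) (sym y-on-i′) (apex-above adm′ z-is-j′))
                         (subst (_< level y) (sym z-on-i) (apex-above adm y-is-j)))

  consecutive-windows : {x y z w : Fin N} → ⟪ x , y , z ⟫ ∈ M → ⟪ y , z , w ⟫ ∈ M →
    ⟪ x , y , z ⟫ ≢ ⟪ y , z , w ⟫ → level y ≡ level z
  consecutive-windows {x} {y} {z} {w} w₁∈M w₂∈M w₁≢w₂ with M-elim w₁∈M | M-elim w₂∈M
  ... | ij , adm , w₁≡ | ij′ , adm′ , w₂≡ =
    shared-pair adm adm′ (λ ij≡ij′ → w₁≢w₂ (trans w₁≡ (trans (cong (uncurry edge) ij≡ij′) (sym w₂≡))))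
      (on (x ∷ y ∷ z ∷ []) w₁≡ (there (here refl))) (on (x ∷ y ∷ z ∷ []) w₁≡ (there (there (here refl))))
      (on (y ∷ z ∷ w ∷ []) w₂≡ (here refl)) (on (y ∷ z ∷ w ∷ []) w₂≡ (there (here refl)))

  -- M has no semicycle: three consecutive windows would put three distinct vertices on one level,
  -- and closing up one or two windows contradicts distinctness of the vertices or windows.
  M-semicycle-free : SemicycleFree 3 N M
  M-semicycle-free [] ((() , _) , _)
  M-semicycle-free (_ ∷ []) ((s≤s () , _) , _)
  M-semicycle-free (_ ∷ _ ∷ []) ((s≤s (s≤s ()) , _) , _)
  M-semicycle-free (p ∷ q ∷ r ∷ []) ((_ , (card , _) All.∷ All.[] , _) , _ , mid , closed) =
    proj₁ (proj₂ (∣⟪⟫∣≡3⇒distinct card)) (closed-ends (q ∷ []) mid closed)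
  M-semicycle-free (p ∷ q ∷ r ∷ s ∷ []) ((_ , _ , (w₁≢w₂ All.∷ All.[]) ∷ _) , _ , mid , closed) =
    w₁≢w₂ (trans rotate (cong (λ v → ⟪ q , r , v ⟫) (closed-ends (q ∷ r ∷ []) mid closed)))
  M-semicycle-free (p ∷ q ∷ r ∷ s ∷ t ∷ _)
    ((_ , (_ , w₁∈M) All.∷ (card₂ , w₂∈M) All.∷ (_ , w₃∈M) All.∷ _ , (w₁≢w₂ All.∷ _) ∷ (w₂≢w₃ All.∷ _) ∷ _) , _)
    with ∣⟪⟫∣≡3⇒distinct card₂
  ... | q≢r , q≢s , r≢s with level-at-most-two q~r q≢r (sym (trans q~r r~s))
    where
    q~r = consecutive-windows w₁∈M w₂∈M w₁≢w₂
    r~s = consecutive-windows w₂∈M w₃∈M w₂≢w₃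
  ...   | inj₁ s≡q = q≢s (sym s≡q)
  ...   | inj₂ s≡r = r≢s (sym s≡r)

  chain₁ : {p q r : Fin N} → ⟪ p , q , r ⟫ ∈ M → p ≢ r → IsChainSeq 3 N M (p ∷ q ∷ r ∷ [])
  chain₁ {p} {q} {r} w∈M p≢r =
    (s≤s (s≤s (s≤s z≤n)) , (M-card w∈M , w∈M) All.∷ All.[] , All.[] ∷ []) , p , q ∷ [] , r , refl , p≢r

  chain₂ : {p q r s : Fin N} → ⟪ p , q , r ⟫ ∈ M → ⟪ q , r , s ⟫ ∈ M → ⟪ p , q , r ⟫ ≢ ⟪ q , r , s ⟫ →
    p ≢ s → IsChainSeq 3 N M (p ∷ q ∷ r ∷ s ∷ [])
  chain₂ {p} {q} {r} {s} w₁∈M w₂∈M w₁≢w₂ p≢s =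
    (s≤s (s≤s (s≤s z≤n)) , (M-card w₁∈M , w₁∈M) All.∷ (M-card w₂∈M , w₂∈M) All.∷ All.[] ,
     (w₁≢w₂ All.∷ All.[]) ∷ All.[] ∷ []) ,
    p , q ∷ r ∷ [] , s , refl , p≢s

  Connected : Fin N → Fin N → Set
  Connected u v = Σ (List (Fin N)) λ vs → IsChainSeq 3 N M vs × u ∈ vs × v ∈ vs

  -- A vertex u on level 0 is joined to a higher vertex v by the edge {u, u′, v}, u′ its partner.
  connect-from-bottom : {u v : Fin N} → level u ≡ 0 → 0 < level v → u ≢ v → Connected u v
  connect-from-bottom {u} {v} u₀ v₊ u≢v with partner u
  ... | u′ , u≢u′ , u′~u =
    u ∷ u′ ∷ v ∷ [] , chain₁ (triple∈M u≢u′ (sym u′~u) (subst (_< level v) (sym u₀) v₊)) u≢v ,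
    here refl , there (there (here refl))

  -- For m ≥ 2 any two vertices are joined by a chain of at most two windows meeting level 0.
  M-chain-connected : 1 < m → ChainConnected 3 N M
  M-chain-connected 1<m u v u≢v with level u ℕ.≟ 0 | level v ℕ.≟ 0
  ... | yes u₀ | no v₊ = connect-from-bottom u₀ (ℕ.n≢0⇒n>0 v₊) u≢v
  ... | no u₊ | yes v₀ with connect-from-bottom v₀ (ℕ.n≢0⇒n>0 u₊) (u≢v ∘ sym)
  ...   | vs , chain , v∈ , u∈ = vs , chain , u∈ , v∈
  M-chain-connected 1<m u v u≢v | yes u₀ | yes v₀ with level-pair 1<m
  ... | w , _ , _ , w₁ , _ =
    u ∷ v ∷ w ∷ [] , chain₁ (triple∈M u≢v (trans u₀ (sym v₀)) u<w) (λ u≡w → ℕ.<-irrefl (cong level u≡w) u<w) ,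
    here refl , there (here refl)
    where
    u<w : level u < level w
    u<w = subst₂ _<_ (sym u₀) (sym w₁) (s≤s z≤n)
  M-chain-connected 1<m u v u≢v | no u₊ | no v₊ with level-pair (ℕ.<-trans (s≤s z≤n) 1<m)
  ... | o₀ , o₁ , o₀≢o₁ , o₀-bottom , o₁-bottom =
    u ∷ o₀ ∷ o₁ ∷ v ∷ [] ,
    chain₂ (subst (_∈ M) (sym rotate) (bottom-edge u₊)) (bottom-edge v₊) windows-differ u≢v ,
    here refl , there (there (there (here refl)))
    where
    bottom-edge : ∀ {x} → level x ≢ 0 → ⟪ o₀ , o₁ , x ⟫ ∈ M
    bottom-edge x₊ =
      triple∈M o₀≢o₁ (trans o₀-bottom (sym o₁-bottom)) (subst (_< _) (sym o₀-bottom) (ℕ.n≢0⇒n>0 x₊))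
    windows-differ : ⟪ u , o₀ , o₁ ⟫ ≢ ⟪ o₀ , o₁ , v ⟫
    windows-differ eq
      with ∈-toSet⁻ (o₀ ∷ o₁ ∷ v ∷ []) (subst (u ∈ₛ_) eq (∈-toSet⁺ {vs = u ∷ o₀ ∷ o₁ ∷ []} (here refl)))
    ... | here refl = u₊ o₀-bottom
    ... | there (here refl) = u₊ o₁-bottom
    ... | there (there (here refl)) = u≢v refl

  -- A 3-set {s, t, a} outside M whose vertex a lies below s and t closes up the semicycle
  -- s t a a′ s, whose other windows are the edges {a, a′, t} and {a, a′, s} (a′ the partner of a).
  semicycle-below : {s t a : Fin N} → ⟪ s , t , a ⟫ ∉ M → s ≢ t → level a < level s → level a < level t →
    Σ (List (Fin N)) (IsSemicycleSeq 3 N (⟪ s , t , a ⟫ ∷ M))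
  semicycle-below {s} {t} {a} e∉M s≢t a<s a<t with partner a
  ... | a′ , a≢a′ , a′~a =
    s ∷ t ∷ a ∷ a′ ∷ s ∷ [] ,
    (s≤s (s≤s (s≤s z≤n)) ,
     (distinct⇒∣⟪⟫∣≡3 s≢t (above a<s) (above a<t) , here refl) All.∷
     (M-card w₂∈M , there w₂∈M) All.∷ (M-card w₃∈M , there w₃∈M) All.∷ All.[] ,
     (outside-M w₂∈M All.∷ outside-M w₃∈M All.∷ All.[]) ∷ (w₂≢w₃ All.∷ All.[]) ∷ All.[] ∷ []) ,
    s , t ∷ a ∷ a′ ∷ [] , refl
    where
    above : ∀ {x} → level a < level x → x ≢ a
    above a<x refl = ℕ.<-irrefl refl a<x
    w₂∈M : ⟪ t , a , a′ ⟫ ∈ M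
    w₂∈M = subst (_∈ M) (trans rotate rotate) (triple∈M a≢a′ (sym a′~a) a<t)
    w₃∈M : ⟪ a , a′ , s ⟫ ∈ M
    w₃∈M = triple∈M a≢a′ (sym a′~a) a<s
    outside-M : ∀ {w} → w ∈ M → ⟪ s , t , a ⟫ ≢ w
    outside-M w∈M refl = e∉M w∈M
    w₂≢w₃ : ⟪ t , a , a′ ⟫ ≢ ⟪ a , a′ , s ⟫
    w₂≢w₃ eq with ∈-toSet⁻ (t ∷ a ∷ a′ ∷ [])
                   (subst (s ∈ₛ_) (sym eq) (∈-toSet⁺ {vs = a ∷ a′ ∷ s ∷ []} (there (there (here refl)))))
    ... | here s≡t = s≢t s≡t
    ... | there (here s≡a) = above a<s s≡a
    ... | there (there (here s≡a′)) = ℕ.<-irrefl (trans (sym a′~a) (cong level (sym s≡a′))) a<s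

  -- Every 3-set e outside M closes a semicycle with M.  List e as x < y < z: if x and y share a
  -- level then e is the edge {x, y, z}; otherwise x lies strictly below y and z.
  M-maximal : (e : Subset N) → ∣ e ∣ ≡ 3 → e ∉ M → ¬ IsHypertree 3 N (e ∷ M)
  M-maximal e card e∉M hypertree with 3-set-increasing e card
  ... | x , y , z , x<y , y<z , e≡ with level x ℕ.≟ level y
  ... | yes x~y = e∉M (subst (_∈ M) (sym e≡) (triple∈M x≢y x~y x-below-z))
    where
    x≢y : x ≢ y
    x≢y = ℕ.<⇒≢ x<y ∘ cong toℕ
    x-below-z : level x < level z
    x-below-z = ℕ.≤∧≢⇒< (ℕ.≤-trans (level-mono x<y) (level-mono y<z)) λ x~z →
      [ (λ z≡x → ℕ.<⇒≢ (ℕ.<-trans x<y y<z) (cong toℕ (sym z≡x))) , (λ z≡y → ℕ.<⇒≢ y<z (cong toℕ (sym z≡y))) ]′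
        (level-at-most-two x~y x≢y (sym x~z))
  ... | no x≁y = uncurry semicycle-free (semicycle-below e′∉M (ℕ.<⇒≢ y<z ∘ cong toℕ) x-below-y x-below-z)
    where
    e≡′ : e ≡ ⟪ y , z , x ⟫
    e≡′ = trans e≡ rotate
    e′∉M : ⟪ y , z , x ⟫ ∉ M
    e′∉M = e∉M ∘ subst (_∈ M) (sym e≡′)
    x-below-y : level x < level y
    x-below-y = ℕ.≤∧≢⇒< (level-mono x<y) x≁y
    x-below-z : level x < level z
    x-below-z = ℕ.<-≤-trans x-below-y (level-mono y<z)
    semicycle-free : SemicycleFree 3 N (⟪ y , z , x ⟫ ∷ M)
    semicycle-free = proj₂ (proj₂ (subst (λ f → IsHypertree 3 N (f ∷ M)) e≡′ hypertree))

  M-size : 4 * length M + N ≡ 2 * (N C 2)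
  M-size = trans (cong (λ l → 4 * l + N) (length-map (uncurry edge) (apexPairs N))) (count-apexPairs m)

theorem12 : (m : ℕ) → 2 < 2 * m →
    Σ (Edges (2 * m)) (λ E →
      IsEdgeMaximalHypertree 3 (2 * m) E
      × (4 * length E + 2 * m ≡ 2 * ((2 * m) C 2)))
theorem12 m 2<2m = M , ((M-uniform , M-chain-connected 1<m , M-semicycle-free) , M-maximal) , M-size
  where
  open Construction m
  1<m : 1 < m
  1<m = ℕ.≰⇒> λ m≤1 → ℕ.<⇒≱ 2<2m (ℕ.*-monoʳ-≤ 2 m≤1)
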